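{- Let $\vdash$ be a set of sequents satisfying (A), (Mon), (Cut), (Com), ($\land$I), ($\land$E), ($\to$0), ($\to$1), ($\to$2), and let $Thm=\{\psi\in Form:\ \vdash\psi\}$. For every formula $\varphi$ and every set of formulas $\Gamma$: $\Gamma(Thm,\varphi)$ is closed, $\varphi\in\Gamma(Thm,\varphi)$, and $\Gamma\,R_\to\,\Gamma(Thm,\varphi)$.
   Context: Formulas are generated by $\varphi::=p\mid\perp\mid(\varphi\land\varphi)\mid(\varphi\to\varphi)$ with $p$ from a countable set $P0$; $Form$ is the set of formulas; $\land$ is left-associative and binds tighter than $\to$. A sequent is $(\Gamma,\varphi)$ with $\Gamma\subseteq Form$; for a set $\vdash$ of sequents write $\Gamma\vdash\varphi$ for membership, $\psi\vdash\varphi$ for $\{\psi\}\vdash\varphi$, $\vdash\varphi$ for $\emptyset\vdash\varphi$. Rules (for all $\Gamma,\Delta\subseteq Form$, formulas $\varphi,\psi,\chi$): (A) $\Gamma\cup\{\varphi\}\vdash\varphi$; (Mon) $\Gamma\subseteq\Delta$, $\Gamma\vdash\varphi$ imply $\Delta\vdash\varphi$; (Cut) $\Gamma\cup\{\psi\}\vdash\varphi$, $\Delta\vdash\psi$ imply $\Gamma\cup\Delta\vdash\varphi$; (Com) if $\Gamma\vdash\varphi$ then $\Gamma'\vdash\varphi$ for some finite $\Gamma'\subseteq\Gamma$; ($\land$I) $\{\varphi,\psi\}\vdash\varphi\land\psi$; ($\land$E) $\varphi\land\psi\vdash\varphi$, $\varphi\land\psi\vdash\psi$; ($\to$0) $\vdash\varphi\to\varphi$;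 ($\to$1) if $\Gamma\vdash\varphi$ then $\{\psi\to\chi:\chi\in\Gamma\}\vdash\psi\to\varphi$; ($\to$2) $\{\varphi\to\psi,\psi\to\chi\}\vdash\varphi\to\chi$. A set $\Gamma$ is closed if $\Gamma\vdash\psi$ implies $\psi\in\Gamma$. $\Gamma R_\to\Delta$ means: for all formulas $\varphi,\psi$, if $\varphi\to\psi\in\Gamma$ and $\varphi\in\Delta$ then $\psi\in\Delta$. $\Gamma(\Delta,\varphi)=\{\psi\in Form:\exists\alpha\in\Delta,\ \Gamma\vdash\alpha\land\varphi\to\psi\}$. -}

module Defs where

open import Data.Nat using (ℕ)
open import Data.Product using (Σ; ∃; _×_; _,_)
open import Data.Sum using (_⊎_)
open import Data.Empty using (⊥)
open import Data.List using (List)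
open import Data.List.Membership.Propositional using (_∈_)
open import Relation.Binary.PropositionalEquality using (_≡_)

infixr 5 _⇒_
infixl 6 _∧_
data Form : Set where
  var : ℕ → Form
  ⊥f  : Form
  _∧_ : Form → Form → Form
  _⇒_ : Form → Form → Form

FSet : Set₁
FSet = Form → Set

_⊆_ : FSet → FSet → Set
Γ ⊆ Δ = ∀ φ → Γ φ → Δ φ

_∪_ : FSet → FSet → FSet
(Γ ∪ Δ) φ = Γ φ ⊎ Δ φ

∅ : FSet
∅ _ = ⊥

｛_｝ : Form → FSet
｛ φ ｝ ψ = ψ ≡ φ

pair : Form → Form → FSet
pair φ χ ψ = (ψ ≡ φ) ⊎ (ψ ≡ χ)

listSet : List Form → FSet
listSet xs φ = φ ∈ xs

imp-image : Form → FSet → FSet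
imp-image ψ Γ θ = Σ Form λ χ → Γ χ × (θ ≡ (ψ ⇒ χ))

Consequence : Set₁
Consequence = FSet → Form → Set

record Rules (_⊢_ : Consequence) : Set₁ where
  field
    A    : ∀ Γ φ → (Γ ∪ ｛ φ ｝) ⊢ φ
    Mon  : ∀ Γ Δ φ → Γ ⊆ Δ → Γ ⊢ φ → Δ ⊢ φ
    Cut  : ∀ Γ Δ φ ψ → (Γ ∪ ｛ ψ ｝) ⊢ φ → Δ ⊢ ψ → (Γ ∪ Δ) ⊢ φ
    Com  : ∀ Γ φ → Γ ⊢ φ → Σ (List Form) λ xs → (listSet xs ⊆ Γ) × (listSet xs ⊢ φ)
    ∧I   : ∀ φ ψ → pair φ ψ ⊢ (φ ∧ ψ)
    ∧E₁  : ∀ φ ψ → ｛ φ ∧ ψ ｝ ⊢ φ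
    ∧E₂  : ∀ φ ψ → ｛ φ ∧ ψ ｝ ⊢ ψ
    →0   : ∀ φ → ∅ ⊢ (φ ⇒ φ)
    →1   : ∀ Γ φ ψ → Γ ⊢ φ → imp-image ψ Γ ⊢ (ψ ⇒ φ)
    →2   : ∀ φ ψ χ → pair (φ ⇒ ψ) (ψ ⇒ χ) ⊢ (φ ⇒ χ)

module _ (_⊢_ : Consequence) where

  Closed : FSet → Set
  Closed Γ = ∀ ψ → Γ ⊢ ψ → Γ ψ

  R→ : FSet → FSet → Set
  R→ Γ Δ = ∀ φ ψ → Γ (φ ⇒ ψ) → Δ φ → Δ ψ

  Thm : FSet
  Thm ψ = ∅ ⊢ ψ

  -- Γ(Δ, φ) = { ψ : ∃ α ∈ Δ, Γ ⊢ α ∧ φ → ψ }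
  ext : FSet → FSet → Form → FSet
  ext Γ Δ φ ψ = Σ Form λ α → Δ α × (Γ ⊢ (α ∧ φ ⇒ ψ))

{-# OPTIONS --safe #-}
-- The witnesses α in Γ(Thm, φ) can be pooled: for finitely many members, the conjunction of
-- their witnesses is again a theorem and witnesses all of them at once, because
-- ⊢ (α ∧ α') ∧ φ → α ∧ φ.  Closure then follows from compactness and rule (→1), which
-- turns a derivation from x₁ … xₙ into one of (α ∧ φ → ψ) from the α ∧ φ → xᵢ.
module Submission where

open import Defs
open import Data.Product using (_×_; Σ; _,_)
open import Data.Sum using (inj₁; inj₂)
open import Data.List using (List; []; _∷_)
open import Data.List.Relation.Unary.Any using (here; there)
open import Data.List.Membership.Propositional using (_∈_)
open import Relation.Binary.PropositionalEquality using (refl)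

module DerivedRules (_⊢_ : Consequence) (rules : Rules _⊢_) where
  open Rules rules

  infix 4 _⊢*_
  _⊢*_ : FSet → FSet → Set
  Γ ⊢* Δ = ∀ δ → Δ δ → Γ ⊢ δ

  assumption : ∀ {Γ a} → Γ a → Γ ⊢ a
  assumption {Γ} {a} a∈Γ = Mon (Γ ∪ ｛ a ｝) Γ a absorb (A Γ a)
    where
      absorb : (Γ ∪ ｛ a ｝) ⊆ Γ
      absorb θ (inj₁ θ∈Γ) = θ∈Γ
      absorb θ (inj₂ refl) = a∈Γ

  theorem-weaken : ∀ {Γ χ} → ∅ ⊢ χ → Γ ⊢ χ
  theorem-weaken {Γ} {χ} = Mon ∅ Γ χ (λ θ ())

  cut-list : ∀ {Γ χ} (ys : List Form) → Γ ⊢* listSet ys → (listSet ys ∪ Γ) ⊢ χ → Γ ⊢ χ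
  cut-list {Γ} {χ} [] _ d = Mon (listSet [] ∪ Γ) Γ χ drop-nil d
    where
      drop-nil : (listSet [] ∪ Γ) ⊆ Γ
      drop-nil θ (inj₁ ())
      drop-nil θ (inj₂ θ∈Γ) = θ∈Γ
  cut-list {Γ} {χ} (y ∷ ys) ⊢ys d =
    cut-list ys (λ θ θ∈ys → ⊢ys θ (there θ∈ys))
      (Mon (S ∪ Γ) S χ merge (Cut S Γ χ y (Mon _ (S ∪ ｛ y ｝) χ split d) (⊢ys y (here refl))))
    where
      S : FSet
      S = listSet ys ∪ Γ
      split : (listSet (y ∷ ys) ∪ Γ) ⊆ (S ∪ ｛ y ｝)
      split θ (inj₁ (here θ≡y)) = inj₂ θ≡y
      split θ (inj₁ (there θ∈ys)) = inj₁ (inj₁ θ∈ys)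
      split θ (inj₂ θ∈Γ) = inj₁ (inj₂ θ∈Γ)
      merge : (S ∪ Γ) ⊆ S
      merge θ (inj₁ θ∈S) = θ∈S
      merge θ (inj₂ θ∈Γ) = inj₂ θ∈Γ

  cut* : ∀ {Γ Δ χ} → Γ ⊢* Δ → Δ ⊢ χ → Γ ⊢ χ
  cut* {Γ} {Δ} {χ} Γ⊢*Δ Δ⊢χ with Com Δ χ Δ⊢χ
  ... | xs , xs⊆Δ , xs⊢χ =
    cut-list xs (λ θ θ∈xs → Γ⊢*Δ θ (xs⊆Δ θ θ∈xs)) (Mon (listSet xs) _ χ (λ θ → inj₁) xs⊢χ)

  cut₁ : ∀ {Γ a b} → Γ ⊢ a → ｛ a ｝ ⊢ b → Γ ⊢ b
  cut₁ ⊢a = cut* λ { θ refl → ⊢a }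

  cut₂ : ∀ {Γ a b c} → Γ ⊢ a → Γ ⊢ b → pair a b ⊢ c → Γ ⊢ c
  cut₂ ⊢a ⊢b = cut* λ { θ (inj₁ refl) → ⊢a ; θ (inj₂ refl) → ⊢b }

  ∧-intro : ∀ {Γ a b} → Γ ⊢ a → Γ ⊢ b → Γ ⊢ (a ∧ b)
  ∧-intro {a = a} {b} ⊢a ⊢b = cut₂ ⊢a ⊢b (∧I a b)

  ∧-elim₁ : ∀ {Γ a b} → Γ ⊢ (a ∧ b) → Γ ⊢ a
  ∧-elim₁ {a = a} {b} ⊢a∧b = cut₁ ⊢a∧b (∧E₁ a b)

  ∧-elim₂ : ∀ {Γ a b} → Γ ⊢ (a ∧ b) → Γ ⊢ b
  ∧-elim₂ {a = a} {b} ⊢a∧b = cut₁ ⊢a∧b (∧E₂ a b)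

  ⇒-trans : ∀ {Γ a b c} → Γ ⊢ (a ⇒ b) → Γ ⊢ (b ⇒ c) → Γ ⊢ (a ⇒ c)
  ⇒-trans {a = a} {b} {c} ⊢ab ⊢bc = cut₂ ⊢ab ⊢bc (→2 a b c)

  ⇒-intro : ∀ {a b} → ｛ a ｝ ⊢ b → ∅ ⊢ (a ⇒ b)
  ⇒-intro {a} {b} a⊢b = cut₁ (→0 a) (Mon (imp-image a ｛ a ｝) ｛ a ⇒ a ｝ (a ⇒ b) image (→1 ｛ a ｝ b a a⊢b))
    where
      image : imp-image a ｛ a ｝ ⊆ ｛ a ⇒ a ｝
      image θ (_ , refl , refl) = refl

  ∧-monoˡ-⇒ : ∀ {a a' φ} → ｛ a' ｝ ⊢ a → ∅ ⊢ (a' ∧ φ ⇒ a ∧ φ)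
  ∧-monoˡ-⇒ a'⊢a = ⇒-intro (∧-intro (cut₁ (∧-elim₁ hyp) a'⊢a) (∧-elim₂ hyp))
    where
      hyp : ∀ {a' φ} → ｛ a' ∧ φ ｝ ⊢ (a' ∧ φ)
      hyp = assumption refl

module Extension (_⊢_ : Consequence) (rules : Rules _⊢_) where
  open Rules rules
  open DerivedRules _⊢_ rules

  Ext : FSet → Form → FSet
  Ext Γ φ = ext _⊢_ Γ (Thm _⊢_) φ

  shared-witness : ∀ {Γ φ} (xs : List Form) → listSet xs ⊆ Ext Γ φ →
    Σ Form λ α → ∅ ⊢ α × (∀ x → x ∈ xs → Γ ⊢ (α ∧ φ ⇒ x))
  shared-witness {φ = φ} [] _ = φ ⇒ φ , →0 φ , λ x ()
  shared-witness {Γ} {φ} (x ∷ xs) xs⊆Ext with xs⊆Ext x (here refl)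
                                           | shared-witness xs (λ θ θ∈xs → xs⊆Ext θ (there θ∈xs))
  ... | α , ⊢α , ⊢αx | α' , ⊢α' , ⊢α'xs = α ∧ α' , ∧-intro ⊢α ⊢α' , witnesses
    where
      witnesses : ∀ y → y ∈ (x ∷ xs) → Γ ⊢ ((α ∧ α') ∧ φ ⇒ y)
      witnesses y (here refl) = ⇒-trans (theorem-weaken (∧-monoˡ-⇒ (∧E₁ α α'))) ⊢αx
      witnesses y (there y∈xs) = ⇒-trans (theorem-weaken (∧-monoˡ-⇒ (∧E₂ α α'))) (⊢α'xs y y∈xs)

  Ext-closed : ∀ Γ φ → Closed _⊢_ (Ext Γ φ)
  Ext-closed Γ φ ψ Ext⊢ψ with Com (Ext Γ φ) ψ Ext⊢ψ
  ... | xs , xs⊆Ext , xs⊢ψ with shared-witness xs xs⊆Ext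
  ... | α , ⊢α , ⊢αxs = α , ⊢α , cut* premises (→1 (listSet xs) ψ (α ∧ φ) xs⊢ψ)
    where
      premises : Γ ⊢* imp-image (α ∧ φ) (listSet xs)
      premises θ (x , x∈xs , refl) = ⊢αxs x x∈xs

  Ext-∋ : ∀ Γ φ → Ext Γ φ φ
  Ext-∋ Γ φ = φ ⇒ φ , →0 φ , theorem-weaken (⇒-intro (∧E₂ (φ ⇒ φ) φ))

  R→-Ext : ∀ Γ φ → R→ _⊢_ Γ (Ext Γ φ)
  R→-Ext Γ φ a b a⇒b∈Γ (α , ⊢α , ⊢αa) = α , ⊢α , ⇒-trans ⊢αa (assumption a⇒b∈Γ)

corollary3 : (_⊢_ : Consequence) → Rules _⊢_ →
    ∀ (φ : Form) (Γ : FSet) →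
      Closed _⊢_ (ext _⊢_ Γ (Thm _⊢_) φ)
      × ext _⊢_ Γ (Thm _⊢_) φ φ
      × R→ _⊢_ Γ (ext _⊢_ Γ (Thm _⊢_) φ)
corollary3 _⊢_ rules φ Γ = Ext-closed Γ φ , Ext-∋ Γ φ , R→-Ext Γ φ
  where open Extension _⊢_ rules
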